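{- Let $(N_1,C_1)$ and $(N_2,C_2)$ be coherent nets and $E$ a Presburger formula with free variables in $P_1\cup P_2$, and suppose $(N_1,C_1)\approxeq_E(N_2,C_2)$. Then the silent reachability set $R_\tau(N_1,C_1)\triangleq\{m'\in\mathbb N^{P_1}\mid \exists m\models C_1.\ m\xRightarrow{\epsilon}m'\}$ is Presburger-definable, i.e. there is a Presburger formula over the places of $N_1$ whose set of models in $\mathbb N^{P_1}$ is exactly $R_\tau(N_1,C_1)$.
   Context: A labeled Petri net $N=(P,T,\mathrm{Pre},\mathrm{Post})$ has finite place set $P$, finite transition set $T$, $\mathrm{Pre},\mathrm{Post}:T\to(P\to\mathbb N)$ and labeling $l:T\to\Sigma\cup\{\tau\}$ with $\tau\notin\Sigma$ silent. A marking is $m:P\to\mathbb N$. $t$ is enabled at $m$ if $m(p)\ge\mathrm{Pre}(t,p)$ for all $p$, and then $m\xrightarrow{t}m'$ with $m'=m-\mathrm{Pre}(t)+\mathrm{Post}(t)$; $m\xRightarrow{\varrho}m'$ is firing along $\varrho\in T^*$. Extend $l$ to $T^*$ by erasing $\tau$. For $\sigma\in\Sigma^*$, $m\xRightarrow{\sigma}m'$ means some $\varrho$ with $l(\varrho)=\sigma$ has $m\xRightarrow{\varrho}m'$ (so $m\xRightarrow{\epsilon}m'$ means reachability using only silent transitions). $m\overset{\epsilon}{\twoheadrightarrow}m'$ iff $m=m'$; for $\sigma\in\Sigma^*,a\in\Sigma$, $m\overset{\sigma a}{\twoheadrightarrow}m'$ iff there exist $m''$, $t$ with $l(t)=a$ and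 $m\xRightarrow{\sigma}m''\xrightarrow{t}m'$. For a Presburger formula $C$ over the places of $N$, $(N,C)$ is a coherent net if for every $m\models C$, $\sigma\in\Sigma^*$, $m\xRightarrow{\sigma}m'$ there is $m''\models C$ with $m\overset{\sigma}{\twoheadrightarrow}m''$ and $m''\xRightarrow{\epsilon}m'$. For markings $m_1\in\mathbb N^{P_1}$, $m_2\in\mathbb N^{P_2}$ (place sets may share places): $m_1\equiv_E m_2$ means they agree on $P_1\cap P_2$ and $m_1\cup m_2$ satisfies $E$ over $\mathbb N$; $m_1\langle C_1EC_2\rangle m_2$ means $m_1\models C_1$, $m_1\equiv_E m_2$, $m_2\models C_2$. $(N_1,C_1)\preceq_E(N_2,C_2)$ means: (S1) for every $m_1\models C_1$ there is $m_2$ with $m_1\langle C_1EC_2\rangle m_2$; (S2) for all $m_1\xRightarrow{\epsilon}m_1'$ in $N_1$ and all $m_2$, $m_1\equiv_E m_2$ implies $m_1'\equiv_E m_2$; (S3) for all $\sigma\in\Sigma^*$, $m_1\xRightarrow{\sigma}m_1'$ in $N_1$ and $m_2,m_2'$ with $m_1\langle C_1EC_2\rangle m_2$ and $m_1'\equiv_E m_2'$, we have $m_2\xRightarrow{\sigma}m_2'$ in $N_2$. $(N_1,C_1)\approxeq_E(N_2,C_2)$ means $(N_1,C_1)\preceq_E(N_2,C_2)$ and $(N_2,C_2)\preceq_E(N_1,C_1)$ (the latter with the roles of the two nets exchanged, using the same $E$). -}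

module Defs where

open import Data.Nat using (ℕ; zero; suc; _+_; _∸_; _≤_)
open import Data.Fin using (Fin)
import Data.Fin as F
open import Data.List using (List; []; _∷_; _∷ʳ_)
open import Data.Maybe using (Maybe; just; nothing)
open import Data.Product using (Σ; ∃; _×_; _,_)
open import Data.Sum using (_⊎_)
open import Data.Empty using (⊥)
open import Relation.Binary.PropositionalEquality using (_≡_)
open import Function.Definitions using (Injective)

data Term (n : ℕ) : Set where
  var   : Fin n → Term n
  const : ℕ → Term n
  plus  : Term n → Term n → Term n

data Formula (n : ℕ) : Set where
  leq  : Term n → Term n → Formula n
  eq   : Term n → Term n → Formula n
  neg  : Formula n → Formula n
  conj : Formula n → Formula n → Formula n
  disj : Formula n → Formula n → Formula n
  ex   : Formula (suc n) → Formula n      -- binds variable F.zero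

Env : ℕ → Set
Env n = Fin n → ℕ

extend : ∀ {n} → ℕ → Env n → Env (suc n)
extend x v F.zero    = x
extend x v (F.suc i) = v i

evalT : ∀ {n} → Term n → Env n → ℕ
evalT (var i)    v = v i
evalT (const c)  v = c
evalT (plus s t) v = evalT s v + evalT t v

⟦_⟧ : ∀ {n} → Formula n → Env n → Set
⟦ leq s t ⟧  v = evalT s v ≤ evalT t v
⟦ eq s t ⟧   v = evalT s v ≡ evalT t v
⟦ neg φ ⟧    v = ⟦ φ ⟧ v → ⊥
⟦ conj φ ψ ⟧ v = ⟦ φ ⟧ v × ⟦ ψ ⟧ v
⟦ disj φ ψ ⟧ v = ⟦ φ ⟧ v ⊎ ⟦ ψ ⟧ v
⟦ ex φ ⟧     v = Σ ℕ λ x → ⟦ φ ⟧ (extend x v)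

-- Labelled Petri nets over alphabet A with places Fin n.
-- Label nothing = silent τ.

record Net (A : Set) (n : ℕ) : Set where
  field
    nT    : ℕ
    pre   : Fin nT → Fin n → ℕ
    post  : Fin nT → Fin n → ℕ
    label : Fin nT → Maybe A
open Net public

Marking : ℕ → Set
Marking n = Fin n → ℕ

_≗ₘ_ : ∀ {n} → Marking n → Marking n → Set
m ≗ₘ m' = ∀ p → m p ≡ m' p

Fire : ∀ {A n} (N : Net A n) → Marking n → Fin (nT N) → Marking n → Set
Fire N m t m' =
  (∀ p → pre N t p ≤ m p) × (∀ p → m' p ≡ (m p ∸ pre N t p) + post N t p)

data Steps {A n} (N : Net A n) : Marking n → List A → Marking n → Set where
  done    : ∀ {m m'} → m ≗ₘ m' → Steps N m [] m'
  silent  : ∀ {m m'' m' σ} (t : Fin (nT N)) → label N t ≡ nothing →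
            Fire N m t m'' → Steps N m'' σ m' → Steps N m σ m'
  visible : ∀ {m m'' m' σ a} (t : Fin (nT N)) → label N t ≡ just a →
            Fire N m t m'' → Steps N m'' σ m' → Steps N m (a ∷ σ) m'

-- m --σ-->> m'  (ending with a visible transition, or m = m' for ε)
data Arrow {A n} (N : Net A n) : Marking n → List A → Marking n → Set where
  nil  : ∀ {m m'} → m ≗ₘ m' → Arrow N m [] m'
  snoc : ∀ {m m'' m' σ a} (t : Fin (nT N)) → label N t ≡ just a →
         Steps N m σ m'' → Fire N m'' t m' → Arrow N m (σ ∷ʳ a) m'

Coherent : ∀ {A n} → Net A n → Formula n → Set
Coherent N C =
  ∀ m σ m' → ⟦ C ⟧ m → Steps N m σ m' →
  ∃ λ m'' → ⟦ C ⟧ m'' × Arrow N m σ m'' × Steps N m'' [] m'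

-- Place sets P₁ = Fin n₁, P₂ = Fin n₂ embedded in P₁ ∪ P₂ = Fin k by
-- injective maps ι₁, ι₂ that jointly cover Fin k (shared places are those
-- in the image of both).

Cover : ∀ {n₁ n₂ k} → (Fin n₁ → Fin k) → (Fin n₂ → Fin k) → Set
Cover {k = k} ι₁ ι₂ =
  ∀ (x : Fin k) → (∃ λ p → ι₁ p ≡ x) ⊎ (∃ λ q → ι₂ q ≡ x)

-- m₁ ≡_E m₂ : m₁ ∪ m₂ is a (well-defined) marking of P₁ ∪ P₂ satisfying E
EqE : ∀ {n₁ n₂ k} → (Fin n₁ → Fin k) → (Fin n₂ → Fin k) → Formula k →
      Marking n₁ → Marking n₂ → Set
EqE {k = k} ι₁ ι₂ E m₁ m₂ =
  Σ (Env k) λ v → (∀ p → v (ι₁ p) ≡ m₁ p) × (∀ q → v (ι₂ q) ≡ m₂ q) × ⟦ E ⟧ v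

Rel : ∀ {n₁ n₂ k} → (Fin n₁ → Fin k) → (Fin n₂ → Fin k) →
      Formula n₁ → Formula k → Formula n₂ → Marking n₁ → Marking n₂ → Set
Rel ι₁ ι₂ C₁ E C₂ m₁ m₂ = ⟦ C₁ ⟧ m₁ × EqE ι₁ ι₂ E m₁ m₂ × ⟦ C₂ ⟧ m₂

Sim : ∀ {A n₁ n₂ k} → (Fin n₁ → Fin k) → (Fin n₂ → Fin k) →
      Net A n₁ → Formula n₁ → Formula k → Net A n₂ → Formula n₂ → Set
Sim ι₁ ι₂ N₁ C₁ E N₂ C₂ =
  (∀ m₁ → ⟦ C₁ ⟧ m₁ → ∃ λ m₂ → Rel ι₁ ι₂ C₁ E C₂ m₁ m₂)
  × (∀ m₁ m₁' → Steps N₁ m₁ [] m₁' → ∀ m₂ →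
       EqE ι₁ ι₂ E m₁ m₂ → EqE ι₁ ι₂ E m₁' m₂)
  × (∀ σ m₁ m₁' → Steps N₁ m₁ σ m₁' → ∀ m₂ m₂' →
       Rel ι₁ ι₂ C₁ E C₂ m₁ m₂ → EqE ι₁ ι₂ E m₁' m₂' → Steps N₂ m₂ σ m₂')

Equiv : ∀ {A n₁ n₂ k} → (Fin n₁ → Fin k) → (Fin n₂ → Fin k) →
        Net A n₁ → Formula n₁ → Formula k → Net A n₂ → Formula n₂ → Set
Equiv ι₁ ι₂ N₁ C₁ E N₂ C₂ =
  Sim ι₁ ι₂ N₁ C₁ E N₂ C₂ × Sim ι₂ ι₁ N₂ C₂ E N₁ C₁

SilentReach : ∀ {A n} → Net A n → Formula n → Marking n → Set
SilentReach N C m' = ∃ λ m → ⟦ C ⟧ m × Steps N m [] m'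

-- A marking m is silently reachable in (N₁,C₁) iff m ≡_E m₂ for some m₂ ⊨ C₂, and the latter set
-- is Presburger: ∃ v ∈ ℕ^(P₁ ∪ P₂). v|P₁ = m ∧ E(v) ∧ C₂(v|P₂). Left to right: from m₀ ⊨ C₁ with
-- m₀ ⇒ε m, (S1) of (N₁,C₁) ⪯_E (N₂,C₂) relates m₀ to some m₂ ⊨ C₂, and (S2) transports m₀ ≡_E m₂
-- along the silent run to m ≡_E m₂. Right to left: (S1) of the converse simulation gives m₁ ⊨ C₁
-- related to m₂, and (S3) for the empty word turns the trivial run m₂ ⇒ε m₂ into m₁ ⇒ε m.
module Submission where

open import Defs
open import Data.Nat using (ℕ; zero; suc; _+_; _≤_)
open import Data.Fin using (Fin; _↑ˡ_; _↑ʳ_; splitAt)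
import Data.Fin as F
open import Data.Fin.Properties using (∀-cons-⇔)
open import Data.Vec.Functional using (_++_; _∷_; head; tail)
open import Data.Vec.Functional.Properties using (lookup-++ˡ; lookup-++ʳ)
open import Data.Product using (Σ; ∃; _×_; _,_; proj₂)
open import Data.Product.Function.NonDependent.Propositional using (_×-⇔_)
open import Data.Product.Function.Dependent.Propositional using (Σ-⇔)
open import Data.Sum.Function.Propositional using (_⊎-⇔_)
open import Data.Sum.Properties using ([,]-map)
open import Data.List using ([])
open import Function using (_∘_)
open import Function.Definitions using (Injective)
open import Function.Bundles using (_⇔_; mk⇔; Equivalence)
open import Function.Construct.Identity using (↠-id; ⇔-id)
import Function.Properties.Equivalence as ⇔
open import Function.Related.TypeIsomorphisms using (¬-cong-⇔)
open import Relation.Binary.PropositionalEquality using (_≡_; _≗_; refl; cong₂)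

open Equivalence using (to; from)

subst₂-⇔ : (R : ℕ → ℕ → Set) {a b c d : ℕ} → a ≡ c → b ≡ d → R a b ⇔ R c d
subst₂-⇔ R refl refl = ⇔-id _

∃-cong-⇔ : {I : Set} {P Q : I → Set} → (∀ i → P i ⇔ Q i) → ∃ P ⇔ ∃ Q
∃-cong-⇔ P⇔Q = Σ-⇔ (↠-id _) (P⇔Q _)

Π-cong-⇔ : {I : Set} {P Q : I → Set} → (∀ i → P i ⇔ Q i) → (∀ i → P i) ⇔ (∀ i → Q i)
Π-cong-⇔ P⇔Q = mk⇔ (λ h i → to (P⇔Q i) (h i)) (λ h i → from (P⇔Q i) (h i))

evalT-cong : ∀ {n} (t : Term n) {v w : Env n} → v ≗ w → evalT t v ≡ evalT t w
evalT-cong (var i)    v≗w = v≗w i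
evalT-cong (const c)  v≗w = refl
evalT-cong (plus s t) v≗w = cong₂ _+_ (evalT-cong s v≗w) (evalT-cong t v≗w)

⟦⟧-cong : ∀ {n} (φ : Formula n) {v w : Env n} → v ≗ w → ⟦ φ ⟧ v ⇔ ⟦ φ ⟧ w
⟦⟧-cong (leq s t)  v≗w = subst₂-⇔ _≤_ (evalT-cong s v≗w) (evalT-cong t v≗w)
⟦⟧-cong (eq s t)   v≗w = subst₂-⇔ _≡_ (evalT-cong s v≗w) (evalT-cong t v≗w)
⟦⟧-cong (neg φ)    v≗w = ¬-cong-⇔ (⟦⟧-cong φ v≗w)
⟦⟧-cong (conj φ ψ) v≗w = ⟦⟧-cong φ v≗w ×-⇔ ⟦⟧-cong ψ v≗w
⟦⟧-cong (disj φ ψ) v≗w = ⟦⟧-cong φ v≗w ⊎-⇔ ⟦⟧-cong ψ v≗w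
⟦⟧-cong (ex φ) {v} {w} v≗w = ∃-cong-⇔ λ x → ⟦⟧-cong φ (extend-cong x)
  where
  extend-cong : ∀ x → extend x v ≗ extend x w
  extend-cong x F.zero    = refl
  extend-cong x (F.suc i) = v≗w i

renameT : ∀ {n m} → (Fin n → Fin m) → Term n → Term m
renameT ρ (var i)    = var (ρ i)
renameT ρ (const c)  = const c
renameT ρ (plus s t) = plus (renameT ρ s) (renameT ρ t)

rename : ∀ {n m} → (Fin n → Fin m) → Formula n → Formula m
rename ρ (leq s t)  = leq (renameT ρ s) (renameT ρ t)
rename ρ (eq s t)   = eq (renameT ρ s) (renameT ρ t)
rename ρ (neg φ)    = neg (rename ρ φ)
rename ρ (conj φ ψ) = conj (rename ρ φ) (rename ρ ψ)
rename ρ (disj φ ψ) = disj (rename ρ φ) (rename ρ ψ)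
rename ρ (ex φ)     = ex (rename (F.lift 1 ρ) φ)

evalT-rename : ∀ {n m} (ρ : Fin n → Fin m) (t : Term n) {v : Env m} {w : Env n} →
               v ∘ ρ ≗ w → evalT (renameT ρ t) v ≡ evalT t w
evalT-rename ρ (var i)    v∘ρ≗w = v∘ρ≗w i
evalT-rename ρ (const c)  v∘ρ≗w = refl
evalT-rename ρ (plus s t) v∘ρ≗w =
  cong₂ _+_ (evalT-rename ρ s v∘ρ≗w) (evalT-rename ρ t v∘ρ≗w)

⟦⟧-rename : ∀ {n m} (ρ : Fin n → Fin m) (φ : Formula n) {v : Env m} {w : Env n} →
            v ∘ ρ ≗ w → ⟦ rename ρ φ ⟧ v ⇔ ⟦ φ ⟧ w
⟦⟧-rename ρ (leq s t)  h = subst₂-⇔ _≤_ (evalT-rename ρ s h) (evalT-rename ρ t h)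
⟦⟧-rename ρ (eq s t)   h = subst₂-⇔ _≡_ (evalT-rename ρ s h) (evalT-rename ρ t h)
⟦⟧-rename ρ (neg φ)    h = ¬-cong-⇔ (⟦⟧-rename ρ φ h)
⟦⟧-rename ρ (conj φ ψ) h = ⟦⟧-rename ρ φ h ×-⇔ ⟦⟧-rename ρ ψ h
⟦⟧-rename ρ (disj φ ψ) h = ⟦⟧-rename ρ φ h ⊎-⇔ ⟦⟧-rename ρ ψ h
⟦⟧-rename ρ (ex φ) {v} {w} h = ∃-cong-⇔ λ x → ⟦⟧-rename (F.lift 1 ρ) φ (extend-lift x)
  where
  extend-lift : ∀ x → extend x v ∘ F.lift 1 ρ ≗ extend x w
  extend-lift x F.zero    = refl
  extend-lift x (F.suc i) = h i

∃ⁿ : ∀ m {n} → Formula (m + n) → Formula n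
∃ⁿ zero    φ = φ
∃ⁿ (suc m) φ = ∃ⁿ m (ex φ)

++-head-tail : ∀ {m n} (u : Fin (suc m) → ℕ) (v : Env n) → u ++ v ≗ extend (head u) (tail u ++ v)
++-head-tail     u v F.zero    = refl
++-head-tail {m} u v (F.suc i) = [,]-map (splitAt m i)

⟦⟧-∃ⁿ : ∀ m {n} (φ : Formula (m + n)) (v : Env n) → ⟦ ∃ⁿ m φ ⟧ v ⇔ ∃ λ u → ⟦ φ ⟧ (u ++ v)
⟦⟧-∃ⁿ zero    φ v = mk⇔ (λ h → (λ ()) , h) proj₂
⟦⟧-∃ⁿ (suc m) φ v = ⇔.trans (⟦⟧-∃ⁿ m (ex φ) v) (mk⇔ cons uncons)
  where
  cons : (∃ λ u → ⟦ ex φ ⟧ (u ++ v)) → ∃ λ u → ⟦ φ ⟧ (u ++ v)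
  cons (u , x , h) = x ∷ u , from (⟦⟧-cong φ (++-head-tail (x ∷ u) v)) h
  uncons : (∃ λ u → ⟦ φ ⟧ (u ++ v)) → ∃ λ u → ⟦ ex φ ⟧ (u ++ v)
  uncons (u , h) = tail u , head u , to (⟦⟧-cong φ (++-head-tail u v)) h

⋀ : ∀ {n m} → (Fin n → Formula m) → Formula m
⋀ {zero}  f = eq (const 0) (const 0)
⋀ {suc n} f = conj (f F.zero) (⋀ (f ∘ F.suc))

⟦⟧-⋀ : ∀ {n m} (f : Fin n → Formula m) (v : Env m) → ⟦ ⋀ f ⟧ v ⇔ (∀ i → ⟦ f i ⟧ v)
⟦⟧-⋀ {zero}  f v = mk⇔ (λ _ ()) (λ _ → refl)
⟦⟧-⋀ {suc n} f v = ⇔.trans (⇔-id _ ×-⇔ ⟦⟧-⋀ (f ∘ F.suc) v) ∀-cons-⇔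

Definable : ∀ {n} → (Env n → Set) → Set
Definable {n} P = Σ (Formula n) λ φ → (m : Env n) → ⟦ φ ⟧ m ⇔ P m

Definable-⇔ : ∀ {n} {P Q : Env n → Set} → (∀ m → P m ⇔ Q m) → Definable P → Definable Q
Definable-⇔ P⇔Q (φ , φ⇔P) = φ , λ m → ⇔.trans (φ⇔P m) (P⇔Q m)

EqE-image : ∀ {n₁ n₂ k} → (Fin n₁ → Fin k) → (Fin n₂ → Fin k) →
            Formula k → Formula n₂ → Marking n₁ → Set
EqE-image ι₁ ι₂ E C₂ m₁ = ∃ λ m₂ → ⟦ C₂ ⟧ m₂ × EqE ι₁ ι₂ E m₁ m₂

EqE-sym : ∀ {n₁ n₂ k} {ι₁ : Fin n₁ → Fin k} {ι₂ : Fin n₂ → Fin k} {E m₁ m₂} →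
          EqE ι₁ ι₂ E m₁ m₂ → EqE ι₂ ι₁ E m₂ m₁
EqE-sym (v , v|P₁≗m₁ , v|P₂≗m₂ , e) = v , v|P₂≗m₂ , v|P₁≗m₁ , e

EqE-image-definable : ∀ {n₁ n₂ k} (ι₁ : Fin n₁ → Fin k) (ι₂ : Fin n₂ → Fin k)
                      (E : Formula k) (C₂ : Formula n₂) → Definable (EqE-image ι₁ ι₂ E C₂)
EqE-image-definable {n₁} {n₂} {k} ι₁ ι₂ E C₂ =
  ∃ⁿ k ψ , λ m → ⇔.trans (⟦⟧-∃ⁿ k ψ m) (mk⇔ witness⇒image image⇒witness)
  where
  ψ : Formula (k + n₁)
  ψ = conj (⋀ λ p → eq (var (ι₁ p ↑ˡ n₁)) (var (k ↑ʳ p)))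
           (conj (rename (_↑ˡ n₁) E) (rename ((_↑ˡ n₁) ∘ ι₂) C₂))

  module _ {m : Env n₁} (v : Env k) where
    agree : ((v ++ m) ∘ (_↑ˡ n₁)) ≗ v
    agree = lookup-++ˡ v m

    ⟦ψ⟧ : ⟦ ψ ⟧ (v ++ m) ⇔ ((∀ p → v (ι₁ p) ≡ m p) × ⟦ E ⟧ v × ⟦ C₂ ⟧ (v ∘ ι₂))
    ⟦ψ⟧ = ⇔.trans (⟦⟧-⋀ _ (v ++ m))
                  (Π-cong-⇔ λ p → subst₂-⇔ _≡_ (agree (ι₁ p)) (lookup-++ʳ v m p))
          ×-⇔ ⟦⟧-rename _ E agree
          ×-⇔ ⟦⟧-rename _ C₂ (agree ∘ ι₂)

  witness⇒image : ∀ {m} → (∃ λ v → ⟦ ψ ⟧ (v ++ m)) → EqE-image ι₁ ι₂ E C₂ m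
  witness⇒image (v , h) with to (⟦ψ⟧ v) h
  ... | v|P₁≗m , e , c₂ = v ∘ ι₂ , c₂ , v , v|P₁≗m , (λ _ → refl) , e

  image⇒witness : ∀ {m} → EqE-image ι₁ ι₂ E C₂ m → ∃ λ v → ⟦ ψ ⟧ (v ++ m)
  image⇒witness (m₂ , c₂ , v , v|P₁≗m , v|P₂≗m₂ , e) =
    v , from (⟦ψ⟧ v) (v|P₁≗m , e , from (⟦⟧-cong C₂ v|P₂≗m₂) c₂)

module _ {A : Set} {n₁ n₂ k : ℕ} {N₁ : Net A n₁} {C₁ : Formula n₁} {N₂ : Net A n₂}
         {C₂ : Formula n₂} {ι₁ : Fin n₁ → Fin k} {ι₂ : Fin n₂ → Fin k} {E : Formula k} where

  silentReach⇒EqE-image : Sim ι₁ ι₂ N₁ C₁ E N₂ C₂ →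
                          ∀ {m} → SilentReach N₁ C₁ m → EqE-image ι₁ ι₂ E C₂ m
  silentReach⇒EqE-image (S1 , S2 , _) (m₀ , c₁ , m₀⇒m) with S1 m₀ c₁
  ... | m₂ , _ , m₀≡m₂ , c₂ = m₂ , c₂ , S2 m₀ _ m₀⇒m m₂ m₀≡m₂

  EqE-image⇒silentReach : Sim ι₂ ι₁ N₂ C₂ E N₁ C₁ →
                          ∀ {m} → EqE-image ι₁ ι₂ E C₂ m → SilentReach N₁ C₁ m
  EqE-image⇒silentReach (S1 , _ , S3) {m} (m₂ , c₂ , m≡m₂) with S1 m₂ c₂
  ... | m₁ , m₂≈m₁@(_ , _ , c₁) =
    m₁ , c₁ , S3 [] m₂ m₂ (done λ _ → refl) m₁ m m₂≈m₁ (EqE-sym m≡m₂)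

theorem6 : {A : Set} {n₁ n₂ k : ℕ}
    (N₁ : Net A n₁) (C₁ : Formula n₁) (N₂ : Net A n₂) (C₂ : Formula n₂)
    (ι₁ : Fin n₁ → Fin k) (ι₂ : Fin n₂ → Fin k) (E : Formula k) →
    Injective _≡_ _≡_ ι₁ → Injective _≡_ _≡_ ι₂ → Cover ι₁ ι₂ →
    Coherent N₁ C₁ → Coherent N₂ C₂ →
    Equiv ι₁ ι₂ N₁ C₁ E N₂ C₂ →
    Σ (Formula n₁) (λ φ → (m : Marking n₁) → ⟦ φ ⟧ m ⇔ SilentReach N₁ C₁ m)
theorem6 N₁ C₁ N₂ C₂ ι₁ ι₂ E _ _ _ _ _ (N₁⪯N₂ , N₂⪯N₁) =
  Definable-⇔ (λ m → mk⇔ (EqE-image⇒silentReach N₂⪯N₁) (silentReach⇒EqE-image N₁⪯N₂))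
              (EqE-image-definable ι₁ ι₂ E C₂)
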